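{- For every cograph $G$, the following are equivalent: (1) $G$ is $1$-perfectly orientable; (2) $G$ is $K_{2,3}$-free; (3) one of the following holds: $G\cong K_1$; $G\cong\overline{mK_2}$ for some $m\ge 2$; $G$ is the disjoint union of two smaller $1$-perfectly orientable cographs; $G$ is obtained from a $1$-perfectly orientable cograph by adding a universal vertex; $G$ is obtained from a $1$-perfectly orientable cograph by adding a true twin.
   Context: All graphs are finite and simple. Cographs are defined recursively: $K_1$ is a cograph, disjoint unions and joins of two cographs are cographs, and there are no others (equivalently, cographs are the $P_4$-free graphs). $G$ is $H$-free if no induced subgraph of $G$ is isomorphic to $H$. $mK_2$ is the disjoint union of $m$ copies of $K_2$, and $\overline{mK_2}$ its complement. An orientation of a graph $G$ is $1$-perfect if for every vertex $v$, its out-neighborhood is a clique in $G$; $G$ is $1$-perfectly orientable if it admits a $1$-perfect orientation. A universal vertex is adjacent to all other vertices; adding a true twin of a vertex $w$ means adding a new vertex $v$ adjacent to $w$ and to all neighbors of $w$, and to nothing else. -}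

module Defs where

open import Data.Nat using (ℕ; zero; suc; _+_)
open import Data.Fin using (Fin; zero; suc; splitAt; _≟_)
open import Data.Bool using (Bool; true; false; not; _∨_; if_then_else_)
open import Data.Bool.Properties using (∨-comm)
open import Data.Sum using (_⊎_; inj₁; inj₂)
open import Data.Product using (Σ; _×_; _,_; ∃)
open import Relation.Nullary using (¬_; does; yes; no)
open import Relation.Binary.PropositionalEquality using (_≡_; _≢_; refl; sym; cong)
open import Function.Definitions using (Injective)

record Graph : Set where
  field
    n      : ℕ
    adj    : Fin n → Fin n → Bool
    adjSym : ∀ u v → adj u v ≡ adj v u
    adjIrr : ∀ v → adj v v ≡ false
open Graph public

record _≅_ (G H : Graph) : Set where
  field
    f     : Fin (n G) → Fin (n H)
    g     : Fin (n H) → Fin (n G)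
    gf    : ∀ x → g (f x) ≡ x
    fg    : ∀ y → f (g y) ≡ y
    pres  : ∀ u v → adj H (f u) (f v) ≡ adj G u v

record _↪_ (H G : Graph) : Set where
  field
    emb    : Fin (n H) → Fin (n G)
    embInj : Injective _≡_ _≡_ emb
    embAdj : ∀ u v → adj G (emb u) (emb v) ≡ adj H u v

_Free_ : Graph → Graph → Set
G Free H = ¬ (H ↪ G)

edgeless : ℕ → Graph
edgeless k = record { n = k ; adj = λ _ _ → false ; adjSym = λ _ _ → refl ; adjIrr = λ _ → refl }

K₁ : Graph
K₁ = edgeless 1

sumAdj : ∀ {a b} → Bool → (Fin a → Fin a → Bool) → (Fin b → Fin b → Bool)
       → Fin a ⊎ Fin b → Fin a ⊎ Fin b → Bool
sumAdj c A B (inj₁ x) (inj₁ y) = A x y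
sumAdj c A B (inj₁ x) (inj₂ y) = c
sumAdj c A B (inj₂ x) (inj₁ y) = c
sumAdj c A B (inj₂ x) (inj₂ y) = B x y

sumAdjSym : ∀ {a b} c (A : Fin a → Fin a → Bool) (B : Fin b → Fin b → Bool)
  → (∀ u v → A u v ≡ A v u) → (∀ u v → B u v ≡ B v u)
  → ∀ x y → sumAdj c A B x y ≡ sumAdj c A B y x
sumAdjSym c A B sA sB (inj₁ x) (inj₁ y) = sA x y
sumAdjSym c A B sA sB (inj₁ x) (inj₂ y) = refl
sumAdjSym c A B sA sB (inj₂ x) (inj₁ y) = refl
sumAdjSym c A B sA sB (inj₂ x) (inj₂ y) = sB x y

sumAdjIrr : ∀ {a b} c (A : Fin a → Fin a → Bool) (B : Fin b → Fin b → Bool)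
  → (∀ u → A u u ≡ false) → (∀ u → B u u ≡ false)
  → ∀ x → sumAdj c A B x x ≡ false
sumAdjIrr c A B iA iB (inj₁ x) = iA x
sumAdjIrr c A B iA iB (inj₂ x) = iB x

-- c = false: disjoint union; c = true: join
combine : Bool → Graph → Graph → Graph
combine c G H = record
  { n = n G + n H
  ; adj = λ x y → sumAdj c (adj G) (adj H) (splitAt (n G) x) (splitAt (n G) y)
  ; adjSym = λ x y → sumAdjSym c (adj G) (adj H) (adjSym G) (adjSym H) (splitAt (n G) x) (splitAt (n G) y)
  ; adjIrr = λ x → sumAdjIrr c (adj G) (adj H) (adjIrr G) (adjIrr H) (splitAt (n G) x)
  }

_⊕_ : Graph → Graph → Graph
G ⊕ H = combine false G H

_⊗_ : Graph → Graph → Graph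
G ⊗ H = combine true G H

complement : Graph → Graph
complement G = record
  { n = n G
  ; adj = λ u v → if does (u ≟ v) then false else not (adj G u v)
  ; adjSym = symC
  ; adjIrr = λ v → irrC v
  }
  where
  symC : ∀ u v → (if does (u ≟ v) then false else not (adj G u v))
               ≡ (if does (v ≟ u) then false else not (adj G v u))
  symC u v with u ≟ v | v ≟ u
  ... | yes _ | yes _ = refl
  ... | yes p | no q = Data.Empty.⊥-elim (q (sym p)) where import Data.Empty
  ... | no p | yes q = Data.Empty.⊥-elim (p (sym q)) where import Data.Empty
  ... | no _ | no _ = cong not (adjSym G u v)
  irrC : ∀ v → (if does (v ≟ v) then false else not (adj G v v)) ≡ false
  irrC v with v ≟ v
  ... | yes _ = refl
  ... | no q = Data.Empty.⊥-elim (q refl) where import Data.Empty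

K₂ : Graph
K₂ = K₁ ⊗ K₁

mK₂ : ℕ → Graph
mK₂ zero    = edgeless 0
mK₂ (suc m) = K₂ ⊕ mK₂ m

co-mK₂ : ℕ → Graph
co-mK₂ m = complement (mK₂ m)

K₂₃ : Graph
K₂₃ = edgeless 2 ⊗ edgeless 3

addUniversal : Graph → Graph
addUniversal G = G ⊗ K₁

-- adding a true twin of vertex w : the new vertex is `zero`, old vertex v is `suc v`
twinAdj : (G : Graph) → Fin (n G) → Fin (suc (n G)) → Fin (suc (n G)) → Bool
twinAdj G w zero    zero    = false
twinAdj G w zero    (suc v) = does (v ≟ w) ∨ adj G w v
twinAdj G w (suc u) zero    = does (u ≟ w) ∨ adj G w u
twinAdj G w (suc u) (suc v) = adj G u v

addTrueTwin : (G : Graph) → Fin (n G) → Graph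
addTrueTwin G w = record
  { n = suc (n G)
  ; adj = twinAdj G w
  ; adjSym = s
  ; adjIrr = i
  }
  where
  s : ∀ u v → twinAdj G w u v ≡ twinAdj G w v u
  s zero zero = refl
  s zero (suc v) = refl
  s (suc u) zero = refl
  s (suc u) (suc v) = adjSym G u v
  i : ∀ v → twinAdj G w v v ≡ false
  i zero = refl
  i (suc v) = adjIrr G v

data Cograph : Graph → Set where
  cg-K₁    : ∀ {G} → G ≅ K₁ → Cograph G
  cg-union : ∀ {G A B} → Cograph A → Cograph B → G ≅ (A ⊕ B) → Cograph G
  cg-join  : ∀ {G A B} → Cograph A → Cograph B → G ≅ (A ⊗ B) → Cograph G

record Orientation (G : Graph) : Set where
  field
    out       : Fin (n G) → Fin (n G) → Bool
    out⇒adj   : ∀ u v → out u v ≡ true → adj G u v ≡ true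
    adj⇒out   : ∀ u v → adj G u v ≡ true → out u v ≡ true ⊎ out v u ≡ true
    outAntisym : ∀ u v → out u v ≡ true → out v u ≡ false
open Orientation public

OnePerfect : (G : Graph) → Orientation G → Set
OnePerfect G o = ∀ v x y → out o v x ≡ true → out o v y ≡ true → x ≢ y → adj G x y ≡ true

OnePerfectlyOrientable : Graph → Set
OnePerfectlyOrientable G = Σ (Orientation G) (OnePerfect G)

Cond3 : Graph → Set
Cond3 G =
    (G ≅ K₁)
  ⊎ (Σ ℕ λ m → (2 Data.Nat.≤ m) × (G ≅ co-mK₂ m))
  ⊎ (Σ Graph λ A → Σ Graph λ B →
       Cograph A × OnePerfectlyOrientable A × Cograph B × OnePerfectlyOrientable B
       × (G ≅ (A ⊕ B)))
  ⊎ (Σ Graph λ H → Cograph H × OnePerfectlyOrientable H × (G ≅ addUniversal H))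
  ⊎ (Σ Graph λ H → Cograph H × OnePerfectlyOrientable H
       × Σ (Fin (n H)) λ w → (G ≅ addTrueTwin H w))
  where import Data.Nat

-- (1) ⇒ (2): 1-perfect orientability passes to induced subgraphs, and in any orientation of K₂₃ some
-- vertex of the 2-side has two non-adjacent out-neighbours. (3) ⇒ (1): each of the five constructions
-- carries an explicit 1-perfect orientation. (2) ⇒ (3) by induction on the number of vertices; only a
-- join A ⊗ B needs thought. If A contains an independent triple, K₂₃-freeness makes B a clique, so
-- A ⊗ B has a universal vertex. Otherwise A ⊗ B has no independent triple, and such a cograph is K₁,
-- has a universal vertex or a true twin, or is the complement of a perfect matching: the union of two
-- cliques has a true twin unless it is 2K₁, and joins of complements of perfect matchings are again such.
module Submission where

open import Defs
open import Data.Product using (_×_; Σ; ∃; _,_)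
open import Function.Bundles using (_⇔_; mk⇔)

open import Level using (0ℓ)
open import Data.Nat as ℕ using (ℕ; zero; suc; _+_; _<_; z≤n; s≤s)
import Data.Nat.Properties as ℕ
open import Data.Nat.Induction using (<-wellFounded)
open import Data.Fin using (Fin; zero; suc; splitAt; join; _↑ˡ_; _↑ʳ_; _≟_)
import Data.Fin.Properties as Fin
open import Data.Bool using (Bool; true; false; not; _∨_; _∧_; if_then_else_)
import Data.Bool.Properties as Bool
open import Data.Sum as Sum using (_⊎_; inj₁; inj₂)
open import Data.Sum.Properties using (swap-involutive)
open import Data.Unit using (⊤; tt)
open import Data.Empty using (⊥; ⊥-elim)
open import Function using (id; _∘_; _on_)
open import Relation.Nullary using (¬_; Dec; yes; no; does; ¬?; _×-dec_)
open import Relation.Nullary.Decidable as Dec using (dec-true; dec-false)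
open import Relation.Binary.Definitions using (tri<; tri≈; tri>)
open import Relation.Binary.PropositionalEquality
open import Relation.Binary.Bundles using (Setoid)
import Relation.Binary.Construct.On as On
import Relation.Binary.Reasoning.Setoid
import Induction.WellFounded as WF

open _≅_
open _↪_

private
  variable
    X Y : Set

does-⇔ : (x? : Dec X) (y? : Dec Y) → (X → Y) → (Y → X) → does x? ≡ does y?
does-⇔ (yes x) y? f g = sym (dec-true y? (f x))
does-⇔ (no ¬x) y? f g = sym (dec-false y? (¬x ∘ g))

does-true⇒ : (x? : Dec X) → does x? ≡ true → X
does-true⇒ (yes x) _ = x

≅-refl : ∀ {G} → G ≅ G
≅-refl = record { f = id ; g = id ; gf = λ _ → refl ; fg = λ _ → refl ; pres = λ _ _ → refl }

≡⇒≅ : ∀ {G H} → G ≡ H → G ≅ H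
≡⇒≅ refl = ≅-refl

≅-sym : ∀ {G H} → G ≅ H → H ≅ G
≅-sym {G} {H} i = record { f = g i ; g = f i ; gf = fg i ; fg = gf i ; pres = pres⁻¹ }
  where
  pres⁻¹ : ∀ u v → adj G (g i u) (g i v) ≡ adj H u v
  pres⁻¹ u v = trans (sym (pres i (g i u) (g i v))) (cong₂ (adj H) (fg i u) (fg i v))

≅-trans : ∀ {G H K} → G ≅ H → H ≅ K → G ≅ K
≅-trans i j = record
  { f = f j ∘ f i ; g = g i ∘ g j
  ; gf = λ x → trans (cong (g i) (gf j (f i x))) (gf i x)
  ; fg = λ y → trans (cong (f j) (fg i (g j y))) (fg j y)
  ; pres = λ u v → trans (pres j (f i u) (f i v)) (pres i u v) }

≅-setoid : Setoid 0ℓ 0ℓ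
≅-setoid = record
  { Carrier = Graph ; _≈_ = _≅_
  ; isEquivalence = record { refl = ≅-refl ; sym = ≅-sym ; trans = ≅-trans } }

module ≅-Reasoning = Relation.Binary.Reasoning.Setoid ≅-setoid

≅⇒↪ : ∀ {G H} → G ≅ H → G ↪ H
≅⇒↪ i = record
  { emb = f i
  ; embInj = λ {x} {y} e → trans (sym (gf i x)) (trans (cong (g i) e) (gf i y))
  ; embAdj = pres i }

↪-trans : ∀ {A B C} → A ↪ B → B ↪ C → A ↪ C
↪-trans e₁ e₂ = record
  { emb = emb e₂ ∘ emb e₁
  ; embInj = embInj e₁ ∘ embInj e₂
  ; embAdj = λ u v → trans (embAdj e₂ (emb e₁ u) (emb e₁ v)) (embAdj e₁ u v) }

Free-hereditary : ∀ {K H G} → H ↪ G → G Free K → H Free K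
Free-hereditary e free k = free (↪-trans k e)

≅⇒≡n : ∀ {G H} → G ≅ H → n G ≡ n H
≅⇒≡n i = Fin.cantor-schröder-bernstein (embInj (≅⇒↪ i)) (embInj (≅⇒↪ (≅-sym i)))

-- G described on a vertex type V in bijection with Fin (n G); isomorphisms between unions, joins and
-- twins are built as bijections between such vertex types, avoiding arithmetic on Fin (a + b).
record Presentation (G : Graph) : Set₁ where
  field
    V      : Set
    to     : Fin (n G) → V
    from   : V → Fin (n G)
    tofrom : ∀ v → to (from v) ≡ v
    fromto : ∀ x → from (to x) ≡ x
    Adj    : V → V → Bool
    adjEq  : ∀ x y → adj G x y ≡ Adj (to x) (to y)
open Presentation

canonical : ∀ G → Presentation G
canonical G = record
  { V = Fin (n G) ; to = id ; from = id ; tofrom = λ _ → refl ; fromto = λ _ → refl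
  ; Adj = adj G ; adjEq = λ _ _ → refl }

≅-via : ∀ {G H} (pG : Presentation G) (pH : Presentation H)
  (φ : V pG → V pH) (ψ : V pH → V pG) → (∀ a → ψ (φ a) ≡ a) → (∀ b → φ (ψ b) ≡ b)
  → (∀ a b → Adj pH (φ a) (φ b) ≡ Adj pG a b) → G ≅ H
≅-via {G} {H} pG pH φ ψ ψφ φψ φ-pres = record
  { f = from pH ∘ φ ∘ to pG
  ; g = from pG ∘ ψ ∘ to pH
  ; gf = λ x → trans (cong (from pG ∘ ψ) (tofrom pH _)) (trans (cong (from pG) (ψφ _)) (fromto pG x))
  ; fg = λ y → trans (cong (from pH ∘ φ) (tofrom pG _)) (trans (cong (from pH) (φψ _)) (fromto pH y))
  ; pres = λ u v → begin
      adj H (from pH (φ (to pG u))) (from pH (φ (to pG v)))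
        ≡⟨ adjEq pH _ _ ⟩
      Adj pH (to pH (from pH (φ (to pG u)))) (to pH (from pH (φ (to pG v))))
        ≡⟨ cong₂ (Adj pH) (tofrom pH _) (tofrom pH _) ⟩
      Adj pH (φ (to pG u)) (φ (to pG v))
        ≡⟨ φ-pres _ _ ⟩
      Adj pG (to pG u) (to pG v)
        ≡⟨ adjEq pG u v ⟨
      adj G u v ∎ }
  where open ≡-Reasoning

⊎-adj : Bool → (X → X → Bool) → (Y → Y → Bool) → X ⊎ Y → X ⊎ Y → Bool
⊎-adj c P Q (inj₁ x) (inj₁ y) = P x y
⊎-adj c P Q (inj₁ x) (inj₂ y) = c
⊎-adj c P Q (inj₂ x) (inj₁ y) = c
⊎-adj c P Q (inj₂ x) (inj₂ y) = Q x y

module _ {G H : Graph} (c : Bool) (pG : Presentation G) (pH : Presentation H) where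
  private
    toS : Fin (n G + n H) → V pG ⊎ V pH
    toS = Sum.map (to pG) (to pH) ∘ splitAt (n G)
    fromS : V pG ⊎ V pH → Fin (n G + n H)
    fromS = join (n G) (n H) ∘ Sum.map (from pG) (from pH)
    tofromS : ∀ s → toS (fromS s) ≡ s
    tofromS (inj₁ p) rewrite Fin.splitAt-↑ˡ (n G) (from pG p) (n H) = cong inj₁ (tofrom pG p)
    tofromS (inj₂ q) rewrite Fin.splitAt-↑ʳ (n G) (n H) (from pH q) = cong inj₂ (tofrom pH q)
    fromtoS : ∀ x s → splitAt (n G) x ≡ s → fromS (toS x) ≡ x
    fromtoS x (inj₁ p) e rewrite e = trans (cong (_↑ˡ n H) (fromto pG p)) (Fin.splitAt⁻¹-↑ˡ e)
    fromtoS x (inj₂ q) e rewrite e = trans (cong (n G ↑ʳ_) (fromto pH q)) (Fin.splitAt⁻¹-↑ʳ e)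
    adjEqS : ∀ s t → sumAdj c (adj G) (adj H) s t
                   ≡ ⊎-adj c (Adj pG) (Adj pH) (Sum.map (to pG) (to pH) s) (Sum.map (to pG) (to pH) t)
    adjEqS (inj₁ p) (inj₁ q) = adjEq pG p q
    adjEqS (inj₁ p) (inj₂ q) = refl
    adjEqS (inj₂ p) (inj₁ q) = refl
    adjEqS (inj₂ p) (inj₂ q) = adjEq pH p q

  combine-presentation : Presentation (combine c G H)
  combine-presentation = record
    { V = V pG ⊎ V pH ; to = toS ; from = fromS ; tofrom = tofromS
    ; fromto = λ x → fromtoS x (splitAt (n G) x) refl
    ; Adj = ⊎-adj c (Adj pG) (Adj pH)
    ; adjEq = λ x y → adjEqS (splitAt (n G) x) (splitAt (n G) y) }

combine-canonical : ∀ c G H → Presentation (combine c G H)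
combine-canonical c G H = combine-presentation c (canonical G) (canonical H)

twin-presentation : ∀ G (w : Fin (n G)) → Presentation G → Presentation (addTrueTwin G w)
twin-presentation G w pG = record
  { V = ⊤ ⊎ V pG ; to = to′ ; from = from′ ; tofrom = tofrom′ ; fromto = fromto′
  ; Adj = Adj′ ; adjEq = adjEq′ }
  where
  to′ : Fin (suc (n G)) → ⊤ ⊎ V pG
  to′ zero = inj₁ tt
  to′ (suc x) = inj₂ (to pG x)
  from′ : ⊤ ⊎ V pG → Fin (suc (n G))
  from′ (inj₁ _) = zero
  from′ (inj₂ p) = suc (from pG p)
  tofrom′ : ∀ s → to′ (from′ s) ≡ s
  tofrom′ (inj₁ tt) = refl
  tofrom′ (inj₂ p) = cong inj₂ (tofrom pG p)
  fromto′ : ∀ x → from′ (to′ x) ≡ x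
  fromto′ zero = refl
  fromto′ (suc x) = cong suc (fromto pG x)
  Adj′ : ⊤ ⊎ V pG → ⊤ ⊎ V pG → Bool
  Adj′ (inj₁ _) (inj₁ _) = false
  Adj′ (inj₁ _) (inj₂ p) = does (from pG p ≟ w) ∨ adj G w (from pG p)
  Adj′ (inj₂ p) (inj₁ _) = does (from pG p ≟ w) ∨ adj G w (from pG p)
  Adj′ (inj₂ p) (inj₂ q) = Adj pG p q
  adjEq′ : ∀ x y → twinAdj G w x y ≡ Adj′ (to′ x) (to′ y)
  adjEq′ zero zero = refl
  adjEq′ zero (suc y) rewrite fromto pG y = refl
  adjEq′ (suc x) zero rewrite fromto pG x = refl
  adjEq′ (suc x) (suc y) = adjEq pG x y

↑ˡ≢↑ʳ : ∀ {m k} (x : Fin m) (y : Fin k) → x ↑ˡ k ≢ m ↑ʳ y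
↑ˡ≢↑ʳ {m} {k} x y e with trans (sym (Fin.splitAt-↑ˡ m x k)) (trans (cong (splitAt m) e) (Fin.splitAt-↑ʳ m k y))
... | ()

splitAt-injective : ∀ m {k} {x y : Fin (m + k)} → splitAt m x ≡ splitAt m y → x ≡ y
splitAt-injective m {k} {x} {y} e =
  trans (sym (Fin.join-splitAt m k x)) (trans (cong (join m k) e) (Fin.join-splitAt m k y))

module _ {c : Bool} {A B : Graph} where
  adj-↑ˡ↑ˡ : ∀ x y → adj (combine c A B) (x ↑ˡ n B) (y ↑ˡ n B) ≡ adj A x y
  adj-↑ˡ↑ˡ x y rewrite Fin.splitAt-↑ˡ (n A) x (n B) | Fin.splitAt-↑ˡ (n A) y (n B) = refl

  adj-↑ˡ↑ʳ : ∀ x y → adj (combine c A B) (x ↑ˡ n B) (n A ↑ʳ y) ≡ c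
  adj-↑ˡ↑ʳ x y rewrite Fin.splitAt-↑ˡ (n A) x (n B) | Fin.splitAt-↑ʳ (n A) (n B) y = refl

  adj-↑ʳ↑ˡ : ∀ x y → adj (combine c A B) (n A ↑ʳ x) (y ↑ˡ n B) ≡ c
  adj-↑ʳ↑ˡ x y rewrite Fin.splitAt-↑ʳ (n A) (n B) x | Fin.splitAt-↑ˡ (n A) y (n B) = refl

  adj-↑ʳ↑ʳ : ∀ x y → adj (combine c A B) (n A ↑ʳ x) (n A ↑ʳ y) ≡ adj B x y
  adj-↑ʳ↑ʳ x y rewrite Fin.splitAt-↑ʳ (n A) (n B) x | Fin.splitAt-↑ʳ (n A) (n B) y = refl

combine-cong : ∀ {c A A′ B B′} → A ≅ A′ → B ≅ B′ → combine c A B ≅ combine c A′ B′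
combine-cong {c} {A} {A′} {B} {B′} i j =
  ≅-via (combine-canonical c A B) (combine-canonical c A′ B′)
    (Sum.map (f i) (f j)) (Sum.map (g i) (g j)) gf′ fg′ pres′
  where
  gf′ : ∀ s → Sum.map (g i) (g j) (Sum.map (f i) (f j) s) ≡ s
  gf′ (inj₁ x) = cong inj₁ (gf i x)
  gf′ (inj₂ x) = cong inj₂ (gf j x)
  fg′ : ∀ s → Sum.map (f i) (f j) (Sum.map (g i) (g j) s) ≡ s
  fg′ (inj₁ x) = cong inj₁ (fg i x)
  fg′ (inj₂ x) = cong inj₂ (fg j x)
  pres′ : ∀ s t → ⊎-adj c (adj A′) (adj B′) (Sum.map (f i) (f j) s) (Sum.map (f i) (f j) t)
                ≡ ⊎-adj c (adj A) (adj B) s t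
  pres′ (inj₁ x) (inj₁ y) = pres i x y
  pres′ (inj₁ x) (inj₂ y) = refl
  pres′ (inj₂ x) (inj₁ y) = refl
  pres′ (inj₂ x) (inj₂ y) = pres j x y

combine-comm : ∀ c A B → combine c A B ≅ combine c B A
combine-comm c A B = ≅-via (combine-canonical c A B) (combine-canonical c B A)
  Sum.swap Sum.swap swap-involutive swap-involutive pres′
  where
  pres′ : ∀ s t → ⊎-adj c (adj B) (adj A) (Sum.swap s) (Sum.swap t) ≡ ⊎-adj c (adj A) (adj B) s t
  pres′ (inj₁ x) (inj₁ y) = refl
  pres′ (inj₁ x) (inj₂ y) = refl
  pres′ (inj₂ x) (inj₁ y) = refl
  pres′ (inj₂ x) (inj₂ y) = refl

module _ {X Y Z : Set} where
  assocˡ-assocʳ : (s : (X ⊎ Y) ⊎ Z) → Sum.assocˡ (Sum.assocʳ s) ≡ s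
  assocˡ-assocʳ (inj₁ (inj₁ x)) = refl
  assocˡ-assocʳ (inj₁ (inj₂ y)) = refl
  assocˡ-assocʳ (inj₂ z) = refl

  assocʳ-assocˡ : (s : X ⊎ (Y ⊎ Z)) → Sum.assocʳ (Sum.assocˡ s) ≡ s
  assocʳ-assocˡ (inj₁ x) = refl
  assocʳ-assocˡ (inj₂ (inj₁ y)) = refl
  assocʳ-assocˡ (inj₂ (inj₂ z)) = refl

combine-assoc : ∀ c A B D → combine c (combine c A B) D ≅ combine c A (combine c B D)
combine-assoc c A B D =
  ≅-via (combine-presentation c (combine-canonical c A B) (canonical D))
        (combine-presentation c (canonical A) (combine-canonical c B D))
        Sum.assocʳ Sum.assocˡ assocˡ-assocʳ assocʳ-assocˡ pres′
  where
  pres′ : ∀ s t → ⊎-adj c (adj A) (⊎-adj c (adj B) (adj D)) (Sum.assocʳ s) (Sum.assocʳ t)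
                ≡ ⊎-adj c (⊎-adj c (adj A) (adj B)) (adj D) s t
  pres′ (inj₁ (inj₁ x)) (inj₁ (inj₁ y)) = refl
  pres′ (inj₁ (inj₁ x)) (inj₁ (inj₂ y)) = refl
  pres′ (inj₁ (inj₁ x)) (inj₂ y) = refl
  pres′ (inj₁ (inj₂ x)) (inj₁ (inj₁ y)) = refl
  pres′ (inj₁ (inj₂ x)) (inj₁ (inj₂ y)) = refl
  pres′ (inj₁ (inj₂ x)) (inj₂ y) = refl
  pres′ (inj₂ x) (inj₁ (inj₁ y)) = refl
  pres′ (inj₂ x) (inj₁ (inj₂ y)) = refl
  pres′ (inj₂ x) (inj₂ y) = refl

combine-twin : ∀ c A B (w : Fin (n A)) →
  combine c (addTrueTwin A w) B ≅ addTrueTwin (combine c A B) (w ↑ˡ n B)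
combine-twin c A B w = ≅-via pL pR Sum.assocʳ Sum.assocˡ assocˡ-assocʳ assocʳ-assocˡ pres′
  where
  pL : Presentation (combine c (addTrueTwin A w) B)
  pL = combine-presentation c (twin-presentation A w (canonical A)) (canonical B)
  pR : Presentation (addTrueTwin (combine c A B) (w ↑ˡ n B))
  pR = twin-presentation (combine c A B) (w ↑ˡ n B) (combine-canonical c A B)
  twin-↑ˡ : ∀ x → (does (x ↑ˡ n B ≟ w ↑ˡ n B) ∨ adj (combine c A B) (w ↑ˡ n B) (x ↑ˡ n B))
                ≡ (does (x ≟ w) ∨ adj A w x)
  twin-↑ˡ x = cong₂ _∨_ (does-⇔ (x ↑ˡ n B ≟ w ↑ˡ n B) (x ≟ w) (Fin.↑ˡ-injective (n B) x w) (cong (_↑ˡ n B)))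
                        (adj-↑ˡ↑ˡ {c} {A} {B} w x)
  twin-↑ʳ : ∀ y → (does (n A ↑ʳ y ≟ w ↑ˡ n B) ∨ adj (combine c A B) (w ↑ˡ n B) (n A ↑ʳ y)) ≡ c
  twin-↑ʳ y = cong₂ _∨_ (dec-false (n A ↑ʳ y ≟ w ↑ˡ n B) (↑ˡ≢↑ʳ w y ∘ sym)) (adj-↑ˡ↑ʳ {c} {A} {B} w y)
  pres′ : ∀ s t → Adj pR (Sum.assocʳ s) (Sum.assocʳ t) ≡ Adj pL s t
  pres′ (inj₁ (inj₁ tt)) (inj₁ (inj₁ tt)) = refl
  pres′ (inj₁ (inj₁ tt)) (inj₁ (inj₂ y)) = twin-↑ˡ y
  pres′ (inj₁ (inj₁ tt)) (inj₂ y) = twin-↑ʳ y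
  pres′ (inj₁ (inj₂ x)) (inj₁ (inj₁ tt)) = twin-↑ˡ x
  pres′ (inj₁ (inj₂ x)) (inj₁ (inj₂ y)) = refl
  pres′ (inj₁ (inj₂ x)) (inj₂ y) = refl
  pres′ (inj₂ x) (inj₁ (inj₁ tt)) = twin-↑ʳ x
  pres′ (inj₂ x) (inj₁ (inj₂ y)) = refl
  pres′ (inj₂ x) (inj₂ y) = refl

complement-cong : ∀ {A B} → A ≅ B → complement A ≅ complement B
complement-cong {A} {B} i = record { f = f i ; g = g i ; gf = gf i ; fg = fg i ; pres = pres′ }
  where
  pres′ : ∀ u v → adj (complement B) (f i u) (f i v) ≡ adj (complement A) u v
  pres′ u v = cong₂ (λ d b → if d then false else not b)
    (does-⇔ (f i u ≟ f i v) (u ≟ v) (embInj (≅⇒↪ i)) (cong (f i))) (pres i u v)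

complement-⊕ : ∀ A B → complement (A ⊕ B) ≅ (complement A ⊗ complement B)
complement-⊕ A B = record { f = id ; g = id ; gf = λ _ → refl ; fg = λ _ → refl ; pres = pres′ }
  where
  on-parts : ∀ s t → sumAdj true (adj (complement A)) (adj (complement B)) s t
    ≡ (if does (join (n A) (n B) s ≟ join (n A) (n B) t) then false else not (sumAdj false (adj A) (adj B) s t))
  on-parts (inj₁ x) (inj₁ y) = cong (λ d → if d then false else not (adj A x y))
    (does-⇔ (x ≟ y) (x ↑ˡ n B ≟ y ↑ˡ n B) (cong (_↑ˡ n B)) (Fin.↑ˡ-injective (n B) x y))
  on-parts (inj₁ x) (inj₂ y) rewrite dec-false (x ↑ˡ n B ≟ n A ↑ʳ y) (↑ˡ≢↑ʳ x y) = refl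
  on-parts (inj₂ x) (inj₁ y) rewrite dec-false (n A ↑ʳ x ≟ y ↑ˡ n B) (↑ˡ≢↑ʳ y x ∘ sym) = refl
  on-parts (inj₂ x) (inj₂ y) = cong (λ d → if d then false else not (adj B x y))
    (does-⇔ (x ≟ y) (n A ↑ʳ x ≟ n A ↑ʳ y) (cong (n A ↑ʳ_)) (Fin.↑ʳ-injective (n A) x y))
  pres′ : ∀ u v → adj (complement A ⊗ complement B) u v ≡ adj (complement (A ⊕ B)) u v
  pres′ u v = trans (on-parts (splitAt (n A) u) (splitAt (n A) v))
    (cong₂ (λ p q → if does (p ≟ q) then false
                     else not (sumAdj false (adj A) (adj B) (splitAt (n A) u) (splitAt (n A) v)))
           (Fin.join-splitAt (n A) (n B) u) (Fin.join-splitAt (n A) (n B) v))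

mK₂-+ : ∀ a b → mK₂ (a + b) ≅ (mK₂ a ⊕ mK₂ b)
mK₂-+ zero b = ≅-refl
mK₂-+ (suc a) b = ≅-trans (combine-cong ≅-refl (mK₂-+ a b)) (≅-sym (combine-assoc false K₂ (mK₂ a) (mK₂ b)))

co-mK₂-+ : ∀ a b → (co-mK₂ a ⊗ co-mK₂ b) ≅ co-mK₂ (a + b)
co-mK₂-+ a b = ≅-sym (≅-trans (complement-cong (mK₂-+ a b)) (complement-⊕ (mK₂ a) (mK₂ b)))

co-mK₂-1 : co-mK₂ 1 ≅ (K₁ ⊕ K₁)
co-mK₂-1 = record { f = id ; g = id ; gf = λ _ → refl ; fg = λ _ → refl ; pres = pres′ }
  where
  pres′ : ∀ u v → adj (K₁ ⊕ K₁) u v ≡ adj (co-mK₂ 1) u v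
  pres′ zero zero = refl
  pres′ zero (suc zero) = refl
  pres′ (suc zero) zero = refl
  pres′ (suc zero) (suc zero) = refl

co-mK₂-1-edgeless : ∀ u v → adj (co-mK₂ 1) u v ≡ false
co-mK₂-1-edgeless zero zero = refl
co-mK₂-1-edgeless zero (suc zero) = refl
co-mK₂-1-edgeless (suc zero) zero = refl
co-mK₂-1-edgeless (suc zero) (suc zero) = refl

complete : ℕ → Graph
complete m = record { n = m ; adj = λ u v → not (does (u ≟ v)) ; adjSym = sym′ ; adjIrr = irr }
  where
  sym′ : ∀ u v → not (does (u ≟ v)) ≡ not (does (v ≟ u))
  sym′ u v = cong not (does-⇔ (u ≟ v) (v ≟ u) sym sym)
  irr : ∀ v → not (does (v ≟ v)) ≡ false
  irr v = cong not (dec-true (v ≟ v) refl)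

Clique : Graph → Set
Clique G = ∀ u v → u ≢ v → adj G u v ≡ true

Clique-K₁ : Clique K₁
Clique-K₁ zero zero 0≢0 = ⊥-elim (0≢0 refl)

Clique⇒≅complete : ∀ {G} → Clique G → G ≅ complete (n G)
Clique⇒≅complete {G} clique = record { f = id ; g = id ; gf = λ _ → refl ; fg = λ _ → refl ; pres = pres′ }
  where
  pres′ : ∀ u v → not (does (u ≟ v)) ≡ adj G u v
  pres′ u v with u ≟ v
  ... | yes refl = sym (adjIrr G u)
  ... | no u≢v = sym (clique u v u≢v)

complete-1 : complete 1 ≅ K₁
complete-1 = record { f = id ; g = id ; gf = λ _ → refl ; fg = λ _ → refl ; pres = λ { zero zero → refl } }

complete-suc : ∀ k → complete (suc (suc k)) ≅ (K₁ ⊗ complete (suc k))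
complete-suc k = record { f = id ; g = id ; gf = λ _ → refl ; fg = λ _ → refl ; pres = pres′ }
  where
  pres′ : ∀ u v → adj (K₁ ⊗ complete (suc k)) u v ≡ adj (complete (suc (suc k))) u v
  pres′ zero zero = refl
  pres′ zero (suc v) = refl
  pres′ (suc u) zero = refl
  pres′ (suc u) (suc v) = refl

complete-twin : ∀ k → complete (suc (suc k)) ≅ addTrueTwin (complete (suc k)) zero
complete-twin k = record { f = id ; g = id ; gf = λ _ → refl ; fg = λ _ → refl ; pres = pres′ }
  where
  pres′ : ∀ u v → twinAdj (complete (suc k)) zero u v ≡ adj (complete (suc (suc k))) u v
  pres′ zero zero = refl
  pres′ zero (suc zero) = refl
  pres′ zero (suc (suc v)) = refl
  pres′ (suc zero) zero = refl
  pres′ (suc (suc u)) zero = refl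
  pres′ (suc u) (suc v) = refl

Cograph-complete : ∀ k → Cograph (complete (suc k))
Cograph-complete zero = cg-K₁ complete-1
Cograph-complete (suc k) = cg-join (cg-K₁ ≅-refl) (Cograph-complete k) (complete-suc k)

≅K₁ : ∀ {G} → (∀ x y → x ≡ y) → Fin (n G) → G ≅ K₁
≅K₁ {G} all-equal x₀ = record
  { f = λ _ → zero ; g = λ _ → x₀ ; gf = all-equal x₀ ; fg = λ { zero → refl } ; pres = pres′ }
  where
  pres′ : ∀ u v → false ≡ adj G u v
  pres′ u v = sym (trans (cong (adj G u) (all-equal v u)) (adjIrr G u))

Fin-subsingleton-or-≥2 : ∀ m → (∀ (x y : Fin m) → x ≡ y) ⊎ ∃ λ k → m ≡ suc (suc k)
Fin-subsingleton-or-≥2 zero = inj₁ λ ()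
Fin-subsingleton-or-≥2 (suc zero) = inj₁ λ { zero zero → refl }
Fin-subsingleton-or-≥2 (suc (suc k)) = inj₂ (k , refl)

Cograph-vertex : ∀ {G} → Cograph G → Fin (n G)
Cograph-vertex (cg-K₁ i) = g i zero
Cograph-vertex (cg-union {B = B} cA cB i) = g i (Cograph-vertex cA ↑ˡ n B)
Cograph-vertex (cg-join {B = B} cA cB i) = g i (Cograph-vertex cA ↑ˡ n B)

↑ˡ-↪ : ∀ {c A B} → A ↪ combine c A B
↑ˡ-↪ {c} {A} {B} = record
  { emb = _↑ˡ n B ; embInj = λ {x} {y} → Fin.↑ˡ-injective (n B) x y ; embAdj = adj-↑ˡ↑ˡ {c} {A} {B} }

↑ʳ-↪ : ∀ {c A B} → B ↪ combine c A B
↑ʳ-↪ {c} {A} {B} = record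
  { emb = n A ↑ʳ_ ; embInj = λ {x} {y} → Fin.↑ʳ-injective (n A) x y ; embAdj = adj-↑ʳ↑ʳ {c} {A} {B} }

twin-↪ : ∀ {H w} → H ↪ addTrueTwin H w
twin-↪ = record { emb = suc ; embInj = Fin.suc-injective ; embAdj = λ _ _ → refl }

combine-mono : ∀ {c P Q A B} → P ↪ A → Q ↪ B → combine c P Q ↪ combine c A B
combine-mono {c} {P} {Q} {A} {B} eP eQ = record
  { emb = h ∘ splitAt (n P)
  ; embInj = λ e → splitAt-injective (n P) (h-injective _ _ e)
  ; embAdj = λ u v → h-adj (splitAt (n P) u) (splitAt (n P) v) }
  where
  h : Fin (n P) ⊎ Fin (n Q) → Fin (n A + n B)
  h (inj₁ p) = emb eP p ↑ˡ n B
  h (inj₂ q) = n A ↑ʳ emb eQ q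
  h-injective : ∀ s t → h s ≡ h t → s ≡ t
  h-injective (inj₁ p) (inj₁ p′) e = cong inj₁ (embInj eP (Fin.↑ˡ-injective (n B) _ _ e))
  h-injective (inj₁ p) (inj₂ q) e = ⊥-elim (↑ˡ≢↑ʳ _ _ e)
  h-injective (inj₂ q) (inj₁ p) e = ⊥-elim (↑ˡ≢↑ʳ _ _ (sym e))
  h-injective (inj₂ q) (inj₂ q′) e = cong inj₂ (embInj eQ (Fin.↑ʳ-injective (n A) _ _ e))
  h-adj : ∀ s t → adj (combine c A B) (h s) (h t) ≡ sumAdj c (adj P) (adj Q) s t
  h-adj (inj₁ p) (inj₁ p′) = trans (adj-↑ˡ↑ˡ {c} {A} {B} _ _) (embAdj eP p p′)
  h-adj (inj₁ p) (inj₂ q) = adj-↑ˡ↑ʳ {c} {A} {B} _ _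
  h-adj (inj₂ q) (inj₁ p) = adj-↑ʳ↑ˡ {c} {A} {B} _ _
  h-adj (inj₂ q) (inj₂ q′) = trans (adj-↑ʳ↑ʳ {c} {A} {B} _ _) (embAdj eQ q q′)

NonEdge : Graph → Set
NonEdge G = Σ (Fin (n G)) λ x → Σ (Fin (n G)) λ y → x ≢ y × adj G x y ≡ false

IndependentTriple : Graph → Set
IndependentTriple G = Σ (Fin (n G)) λ x → Σ (Fin (n G)) λ y → Σ (Fin (n G)) λ z →
  x ≢ y × x ≢ z × y ≢ z × adj G x y ≡ false × adj G x z ≡ false × adj G y z ≡ false

IndependentTriple? : ∀ G → Dec (IndependentTriple G)
IndependentTriple? G = Fin.any? λ x → Fin.any? λ y → Fin.any? λ z →
  ¬? (x ≟ y) ×-dec ¬? (x ≟ z) ×-dec ¬? (y ≟ z) ×-dec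
  adj G x y Bool.≟ false ×-dec adj G x z Bool.≟ false ×-dec adj G y z Bool.≟ false

¬NonEdge⇒Clique : ∀ {G} → ¬ NonEdge G → Clique G
¬NonEdge⇒Clique {G} no-non-edge u v u≢v with adj G u v in uv
... | true = refl
... | false = ⊥-elim (no-non-edge (u , v , u≢v , uv))

IndependentTriple-↪ : ∀ {H G} → H ↪ G → IndependentTriple H → IndependentTriple G
IndependentTriple-↪ e (x , y , z , x≢y , x≢z , y≢z , xy , xz , yz) =
  emb e x , emb e y , emb e z , x≢y ∘ embInj e , x≢z ∘ embInj e , y≢z ∘ embInj e ,
  trans (embAdj e x y) xy , trans (embAdj e x z) xz , trans (embAdj e y z) yz

NonEdge⇒↪ : ∀ {G} → NonEdge G → edgeless 2 ↪ G
NonEdge⇒↪ {G} (x , y , x≢y , xy) = record { emb = h ; embInj = h-injective ; embAdj = h-adj }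
  where
  h : Fin 2 → Fin (n G)
  h zero = x
  h (suc zero) = y
  h-injective : ∀ {u v} → h u ≡ h v → u ≡ v
  h-injective {zero} {zero} _ = refl
  h-injective {zero} {suc zero} e = ⊥-elim (x≢y e)
  h-injective {suc zero} {zero} e = ⊥-elim (x≢y (sym e))
  h-injective {suc zero} {suc zero} _ = refl
  h-adj : ∀ u v → adj G (h u) (h v) ≡ false
  h-adj zero zero = adjIrr G x
  h-adj zero (suc zero) = xy
  h-adj (suc zero) zero = trans (adjSym G y x) xy
  h-adj (suc zero) (suc zero) = adjIrr G y

IndependentTriple⇒↪ : ∀ {G} → IndependentTriple G → edgeless 3 ↪ G
IndependentTriple⇒↪ {G} (x , y , z , x≢y , x≢z , y≢z , xy , xz , yz) =
  record { emb = h ; embInj = h-injective ; embAdj = h-adj }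
  where
  h : Fin 3 → Fin (n G)
  h zero = x
  h (suc zero) = y
  h (suc (suc zero)) = z
  h-injective : ∀ {u v} → h u ≡ h v → u ≡ v
  h-injective {zero} {zero} _ = refl
  h-injective {zero} {suc zero} e = ⊥-elim (x≢y e)
  h-injective {zero} {suc (suc zero)} e = ⊥-elim (x≢z e)
  h-injective {suc zero} {zero} e = ⊥-elim (x≢y (sym e))
  h-injective {suc zero} {suc zero} _ = refl
  h-injective {suc zero} {suc (suc zero)} e = ⊥-elim (y≢z e)
  h-injective {suc (suc zero)} {zero} e = ⊥-elim (x≢z (sym e))
  h-injective {suc (suc zero)} {suc zero} e = ⊥-elim (y≢z (sym e))
  h-injective {suc (suc zero)} {suc (suc zero)} _ = refl
  h-adj : ∀ u v → adj G (h u) (h v) ≡ false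
  h-adj zero zero = adjIrr G x
  h-adj zero (suc zero) = xy
  h-adj zero (suc (suc zero)) = xz
  h-adj (suc zero) zero = trans (adjSym G y x) xy
  h-adj (suc zero) (suc zero) = adjIrr G y
  h-adj (suc zero) (suc (suc zero)) = yz
  h-adj (suc (suc zero)) zero = trans (adjSym G z x) xz
  h-adj (suc (suc zero)) (suc zero) = trans (adjSym G z y) yz
  h-adj (suc (suc zero)) (suc (suc zero)) = adjIrr G z

K₂₃-↪-⊗ : ∀ {A B} → NonEdge A → IndependentTriple B → K₂₃ ↪ (A ⊗ B)
K₂₃-↪-⊗ non-edge triple = combine-mono (NonEdge⇒↪ non-edge) (IndependentTriple⇒↪ triple)

IndependentTriple-⊗ : ∀ {A B} → IndependentTriple (A ⊗ B) → IndependentTriple A ⊎ IndependentTriple B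
IndependentTriple-⊗ {A} {B} (x , y , z , x≢y , x≢z , y≢z , xy , xz , yz) =
  on-parts (splitAt (n A) x) (splitAt (n A) y) (splitAt (n A) z)
    (x≢y ∘ splitAt-injective (n A)) (x≢z ∘ splitAt-injective (n A)) (y≢z ∘ splitAt-injective (n A))
    xy xz yz
  where
  on-parts : ∀ s t r → s ≢ t → s ≢ r → t ≢ r
    → sumAdj true (adj A) (adj B) s t ≡ false → sumAdj true (adj A) (adj B) s r ≡ false
    → sumAdj true (adj A) (adj B) t r ≡ false
    → IndependentTriple A ⊎ IndependentTriple B
  on-parts (inj₁ p) (inj₁ q) (inj₁ r) p≢q p≢r q≢r pq pr qr =
    inj₁ (p , q , r , p≢q ∘ cong inj₁ , p≢r ∘ cong inj₁ , q≢r ∘ cong inj₁ , pq , pr , qr)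
  on-parts (inj₂ p) (inj₂ q) (inj₂ r) p≢q p≢r q≢r pq pr qr =
    inj₂ (p , q , r , p≢q ∘ cong inj₂ , p≢r ∘ cong inj₂ , q≢r ∘ cong inj₂ , pq , pr , qr)
  on-parts (inj₁ _) (inj₁ _) (inj₂ _) _ _ _ _ () _
  on-parts (inj₁ _) (inj₂ _) _ _ _ _ () _ _
  on-parts (inj₂ _) (inj₁ _) _ _ _ _ () _ _
  on-parts (inj₂ _) (inj₂ _) (inj₁ _) _ _ _ _ () _

Clique-⊕ˡ : ∀ {A B} → ¬ IndependentTriple (A ⊕ B) → Fin (n B) → Clique A
Clique-⊕ˡ {A} {B} no-triple b u v u≢v with adj A u v in uv
... | true = refl
... | false = ⊥-elim (no-triple
  ( u ↑ˡ n B , v ↑ˡ n B , n A ↑ʳ b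
  , u≢v ∘ Fin.↑ˡ-injective (n B) u v , ↑ˡ≢↑ʳ u b , ↑ˡ≢↑ʳ v b
  , trans (adj-↑ˡ↑ˡ {false} {A} {B} u v) uv , adj-↑ˡ↑ʳ {false} {A} {B} u b , adj-↑ˡ↑ʳ {false} {A} {B} v b ))

-- 1-perfect orientations

out-irrefl : ∀ {G} (o : Orientation G) v → out o v v ≡ false
out-irrefl {G} o v with out o v v in vv
... | false = refl
... | true with trans (sym (out⇒adj o v v vv)) (adjIrr G v)
... | ()

OnePerfectlyOrientable-hereditary : ∀ {H G} → H ↪ G → OnePerfectlyOrientable G → OnePerfectlyOrientable H
OnePerfectlyOrientable-hereditary {H} {G} e (o , perfect) = o′ , perfect′
  where
  o′ : Orientation H
  o′ = record
    { out = λ u v → out o (emb e u) (emb e v)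
    ; out⇒adj = λ u v uv → trans (sym (embAdj e u v)) (out⇒adj o _ _ uv)
    ; adj⇒out = λ u v uv → adj⇒out o _ _ (trans (embAdj e u v) uv)
    ; outAntisym = λ u v → outAntisym o _ _ }
  perfect′ : OnePerfect H o′
  perfect′ v x y vx vy x≢y = trans (sym (embAdj e x y)) (perfect (emb e v) (emb e x) (emb e y) vx vy (x≢y ∘ embInj e))

-- Each bᵢ has an in-neighbour among a₀, a₁ (were both out-neighbours of bᵢ, they would be adjacent),
-- so one aⱼ has two of the pairwise non-adjacent b₂, b₃, b₄ as out-neighbours.
¬OnePerfectlyOrientable-K₂₃ : ¬ OnePerfectlyOrientable K₂₃
¬OnePerfectlyOrientable-K₂₃ (o , perfect) = pigeonhole (in-side b₂ refl refl) (in-side b₃ refl refl) (in-side b₄ refl refl)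
  where
  a₀ a₁ b₂ b₃ b₄ : Fin 5
  a₀ = zero
  a₁ = suc zero
  b₂ = suc (suc zero)
  b₃ = suc (suc (suc zero))
  b₄ = suc (suc (suc (suc zero)))
  FromSide : Fin 5 → Set
  FromSide b = out o a₀ b ≡ true ⊎ out o a₁ b ≡ true
  in-side : ∀ b → adj K₂₃ a₀ b ≡ true → adj K₂₃ a₁ b ≡ true → FromSide b
  in-side b a₀b a₁b with adj⇒out o a₀ b a₀b | adj⇒out o a₁ b a₁b
  ... | inj₁ a₀→b | _ = inj₁ a₀→b
  ... | inj₂ _ | inj₁ a₁→b = inj₂ a₁→b
  ... | inj₂ b→a₀ | inj₂ b→a₁ with perfect b a₀ a₁ b→a₀ b→a₁ (λ ())
  ... | ()
  clash : ∀ a b b′ → out o a b ≡ true → out o a b′ ≡ true → b ≢ b′ → adj K₂₃ b b′ ≡ false → ⊥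
  clash a b b′ a→b a→b′ b≢b′ bb′ with trans (sym (perfect a b b′ a→b a→b′ b≢b′)) bb′
  ... | ()
  pigeonhole : FromSide b₂ → FromSide b₃ → FromSide b₄ → ⊥
  pigeonhole (inj₁ p) (inj₁ q) _ = clash a₀ b₂ b₃ p q (λ ()) refl
  pigeonhole (inj₂ p) (inj₂ q) _ = clash a₁ b₂ b₃ p q (λ ()) refl
  pigeonhole (inj₁ p) (inj₂ q) (inj₁ r) = clash a₀ b₂ b₄ p r (λ ()) refl
  pigeonhole (inj₁ p) (inj₂ q) (inj₂ r) = clash a₁ b₃ b₄ q r (λ ()) refl
  pigeonhole (inj₂ p) (inj₁ q) (inj₁ r) = clash a₀ b₃ b₄ q r (λ ()) refl
  pigeonhole (inj₂ p) (inj₁ q) (inj₂ r) = clash a₁ b₂ b₄ p r (λ ()) refl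

OnePerfectlyOrientable-K₁ : OnePerfectlyOrientable K₁
OnePerfectlyOrientable-K₁ =
  record { out = λ _ _ → false ; out⇒adj = λ _ _ () ; adj⇒out = λ _ _ () ; outAntisym = λ _ _ () } ,
  λ _ _ _ ()

-- Edges between the sides point from A to B, which is why B must be a clique when the sides are joined.
OnePerfectlyOrientable-combine : ∀ c A B → OnePerfectlyOrientable A → OnePerfectlyOrientable B
  → (c ≡ true → Clique B) → OnePerfectlyOrientable (combine c A B)
OnePerfectlyOrientable-combine c A B (oA , perfectA) (oB , perfectB) joined⇒clique = o , perfect
  where
  Vertex : Set
  Vertex = Fin (n A) ⊎ Fin (n B)
  outV : Vertex → Vertex → Bool
  outV (inj₁ a) (inj₁ a′) = out oA a a′
  outV (inj₁ a) (inj₂ b) = c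
  outV (inj₂ b) (inj₁ a) = false
  outV (inj₂ b) (inj₂ b′) = out oB b b′
  adjV : Vertex → Vertex → Bool
  adjV = sumAdj c (adj A) (adj B)
  out⇒adjV : ∀ s t → outV s t ≡ true → adjV s t ≡ true
  out⇒adjV (inj₁ a) (inj₁ a′) = out⇒adj oA a a′
  out⇒adjV (inj₁ a) (inj₂ b) = id
  out⇒adjV (inj₂ b) (inj₁ a) ()
  out⇒adjV (inj₂ b) (inj₂ b′) = out⇒adj oB b b′
  adj⇒outV : ∀ s t → adjV s t ≡ true → outV s t ≡ true ⊎ outV t s ≡ true
  adj⇒outV (inj₁ a) (inj₁ a′) = adj⇒out oA a a′
  adj⇒outV (inj₁ a) (inj₂ b) = inj₁
  adj⇒outV (inj₂ b) (inj₁ a) = inj₂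
  adj⇒outV (inj₂ b) (inj₂ b′) = adj⇒out oB b b′
  antisymV : ∀ s t → outV s t ≡ true → outV t s ≡ false
  antisymV (inj₁ a) (inj₁ a′) = outAntisym oA a a′
  antisymV (inj₁ a) (inj₂ b) _ = refl
  antisymV (inj₂ b) (inj₁ a) ()
  antisymV (inj₂ b) (inj₂ b′) = outAntisym oB b b′
  perfectV : ∀ s t r → outV s t ≡ true → outV s r ≡ true → t ≢ r → adjV t r ≡ true
  perfectV (inj₁ a) (inj₁ x) (inj₁ y) ax ay x≢y = perfectA a x y ax ay (x≢y ∘ cong inj₁)
  perfectV (inj₁ a) (inj₁ x) (inj₂ y) ax ay x≢y = ay
  perfectV (inj₁ a) (inj₂ x) (inj₁ y) ax ay x≢y = ax
  perfectV (inj₁ a) (inj₂ x) (inj₂ y) ax ay x≢y = joined⇒clique ax x y (x≢y ∘ cong inj₂)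
  perfectV (inj₂ b) (inj₁ x) r () ay x≢y
  perfectV (inj₂ b) (inj₂ x) (inj₁ y) bx () x≢y
  perfectV (inj₂ b) (inj₂ x) (inj₂ y) bx by x≢y = perfectB b x y bx by (x≢y ∘ cong inj₂)
  split : Fin (n A + n B) → Vertex
  split = splitAt (n A)
  o : Orientation (combine c A B)
  o = record
    { out = λ u v → outV (split u) (split v)
    ; out⇒adj = λ u v → out⇒adjV (split u) (split v)
    ; adj⇒out = λ u v → adj⇒outV (split u) (split v)
    ; outAntisym = λ u v → antisymV (split u) (split v) }
  perfect : OnePerfect (combine c A B) o
  perfect v x y vx vy x≢y = perfectV (split v) (split x) (split y) vx vy (x≢y ∘ splitAt-injective (n A))

∨-true-right : ∀ a {b} → b ≡ true → (a ∨ b) ≡ true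
∨-true-right a refl = Bool.∨-zeroʳ a

-- The twin t points to w and to all out-neighbours of w; the in-neighbours of w point to t.
OnePerfectlyOrientable-twin : ∀ G w → OnePerfectlyOrientable G → OnePerfectlyOrientable (addTrueTwin G w)
OnePerfectlyOrientable-twin G w (o , perfect) = o′ , perfect′
  where
  T : Graph
  T = addTrueTwin G w
  outT : Fin (suc (n G)) → Fin (suc (n G)) → Bool
  outT zero zero = false
  outT zero (suc v) = does (v ≟ w) ∨ out o w v
  outT (suc u) zero = out o u w
  outT (suc u) (suc v) = out o u v
  out⇒adjT : ∀ u v → outT u v ≡ true → adj T u v ≡ true
  out⇒adjT zero zero ()
  out⇒adjT zero (suc v) tv with v ≟ w
  ... | yes _ = refl
  ... | no _ = out⇒adj o w v tv
  out⇒adjT (suc u) zero ut = ∨-true-right (does (u ≟ w)) (trans (adjSym G w u) (out⇒adj o u w ut))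
  out⇒adjT (suc u) (suc v) = out⇒adj o u v
  adj⇒outT : ∀ u v → adj T u v ≡ true → outT u v ≡ true ⊎ outT v u ≡ true
  adj⇒outT zero zero ()
  adj⇒outT zero (suc v) tv with v ≟ w
  ... | yes _ = inj₁ refl
  ... | no _ = adj⇒out o w v tv
  adj⇒outT (suc u) zero ut with u ≟ w
  ... | yes _ = inj₂ refl
  ... | no _ = Sum.swap (adj⇒out o w u ut)
  adj⇒outT (suc u) (suc v) = adj⇒out o u v
  antisymT : ∀ u v → outT u v ≡ true → outT v u ≡ false
  antisymT zero zero ()
  antisymT zero (suc v) tv with v ≟ w
  ... | yes refl = out-irrefl o v
  ... | no _ = outAntisym o w v tv
  antisymT (suc u) zero ut with u ≟ w
  ... | no _ = outAntisym o u w ut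
  ... | yes refl with trans (sym ut) (out-irrefl o u)
  ... | ()
  antisymT (suc u) (suc v) = outAntisym o u v
  o′ : Orientation T
  o′ = record { out = outT ; out⇒adj = out⇒adjT ; adj⇒out = adj⇒outT ; outAntisym = antisymT }
  perfect′ : OnePerfect T o′
  perfect′ zero zero _ () _ _
  perfect′ zero _ zero _ () _
  perfect′ zero (suc x) (suc y) tx ty x≢y with x ≟ w | y ≟ w
  ... | yes refl | yes refl = ⊥-elim (x≢y refl)
  ... | yes refl | no _ = out⇒adj o x y ty
  ... | no _ | yes refl = trans (adjSym G x y) (out⇒adj o y x tx)
  ... | no _ | no _ = perfect w x y tx ty (x≢y ∘ cong suc)
  perfect′ (suc v) zero zero _ _ x≢y = ⊥-elim (x≢y refl)
  perfect′ (suc v) zero (suc y) vt vy _ with y ≟ w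
  ... | yes _ = refl
  ... | no y≢w = perfect v w y vt vy (y≢w ∘ sym)
  perfect′ (suc v) (suc x) zero vx vt _ with x ≟ w
  ... | yes _ = refl
  ... | no x≢w = perfect v w x vt vx (x≢w ∘ sym)
  perfect′ (suc v) (suc x) (suc y) vx vy x≢y = perfect v x y vx vy (x≢y ∘ cong suc)

module _ {G : Graph} {_↝_ : Fin (n G) → Fin (n G) → Set} (_↝?_ : ∀ x y → Dec (x ↝ y))
         (↝⇒adj : ∀ x y → x ↝ y → adj G x y ≡ true)
         (adj⇒↝ : ∀ x y → adj G x y ≡ true → x ↝ y ⊎ y ↝ x)
         (↝-asym : ∀ x y → x ↝ y → ¬ y ↝ x) where

  orientation-by : Orientation G
  orientation-by = record
    { out = λ x y → does (x ↝? y)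
    ; out⇒adj = λ x y → ↝⇒adj x y ∘ does-true⇒ (x ↝? y)
    ; adj⇒out = λ x y → Sum.map (dec-true (x ↝? y)) (dec-true (y ↝? x)) ∘ adj⇒↝ x y
    ; outAntisym = λ x y → dec-false (y ↝? x) ∘ ↝-asym x y ∘ does-true⇒ (x ↝? y) }

  OnePerfect-by : (∀ v x y → v ↝ x → v ↝ y → x ≢ y → adj G x y ≡ true) → OnePerfect G orientation-by
  OnePerfect-by perfect v x y vx vy = perfect v x y (does-true⇒ (v ↝? x) vx) (does-true⇒ (v ↝? y) vy)

-- Vertex x of m K₂ is the end `side x` of the edge number `pair x`.
pair : ∀ m → Fin (n (mK₂ m)) → ℕ
pair (suc m) zero = 0
pair (suc m) (suc zero) = 0
pair (suc m) (suc (suc x)) = suc (pair m x)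

side : ∀ m → Fin (n (mK₂ m)) → Bool
side (suc m) zero = false
side (suc m) (suc zero) = true
side (suc m) (suc (suc x)) = side m x

pair-side-injective : ∀ m x y → pair m x ≡ pair m y → side m x ≡ side m y → x ≡ y
pair-side-injective (suc m) zero zero _ _ = refl
pair-side-injective (suc m) zero (suc zero) _ ()
pair-side-injective (suc m) zero (suc (suc y)) () _
pair-side-injective (suc m) (suc zero) zero _ ()
pair-side-injective (suc m) (suc zero) (suc zero) _ _ = refl
pair-side-injective (suc m) (suc zero) (suc (suc y)) () _
pair-side-injective (suc m) (suc (suc x)) zero () _
pair-side-injective (suc m) (suc (suc x)) (suc zero) () _
pair-side-injective (suc m) (suc (suc x)) (suc (suc y)) p s =
  cong (λ z → suc (suc z)) (pair-side-injective m x y (ℕ.suc-injective p) s)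

mK₂-adj : ∀ m x y → adj (mK₂ m) x y ≡ does (pair m x ℕ.≟ pair m y) ∧ not (does (x ≟ y))
mK₂-adj (suc m) zero zero = refl
mK₂-adj (suc m) zero (suc zero) = refl
mK₂-adj (suc m) zero (suc (suc y)) = refl
mK₂-adj (suc m) (suc zero) zero = refl
mK₂-adj (suc m) (suc zero) (suc zero) = refl
mK₂-adj (suc m) (suc zero) (suc (suc y)) = refl
mK₂-adj (suc m) (suc (suc x)) zero = refl
mK₂-adj (suc m) (suc (suc x)) (suc zero) = refl
mK₂-adj (suc m) (suc (suc x)) (suc (suc y)) = mK₂-adj m x y

co-mK₂-adj : ∀ m x y → adj (co-mK₂ m) x y ≡ not (does (pair m x ℕ.≟ pair m y))
co-mK₂-adj m x y with x ≟ y
... | yes refl = cong not (sym (dec-true (pair m x ℕ.≟ pair m x) refl))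
... | no x≢y = cong not (begin
  adj (mK₂ m) x y                                    ≡⟨ mK₂-adj m x y ⟩
  does (pair m x ℕ.≟ pair m y) ∧ not (does (x ≟ y))  ≡⟨ cong (λ d → does (pair m x ℕ.≟ pair m y) ∧ not d) (dec-false (x ≟ y) x≢y) ⟩
  does (pair m x ℕ.≟ pair m y) ∧ true                ≡⟨ Bool.∧-identityʳ _ ⟩
  does (pair m x ℕ.≟ pair m y)                       ∎)
  where open ≡-Reasoning

-- Between ends of distinct edges p, q of m K₂, same-side ends point towards the larger edge number and
-- opposite-side ends towards the smaller one; so no vertex points to both ends of one edge.
data _⇢_ : ℕ × Bool → ℕ × Bool → Set where
  same  : ∀ {p q s} → p < q → (p , s) ⇢ (q , s)
  cross : ∀ {p q s} → q < p → (p , s) ⇢ (q , not s)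

_⇢?_ : ∀ a b → Dec (a ⇢ b)
(p , false) ⇢? (q , false) = Dec.map′ same (λ { (same p<q) → p<q }) (p ℕ.<? q)
(p , true)  ⇢? (q , true)  = Dec.map′ same (λ { (same p<q) → p<q }) (p ℕ.<? q)
(p , false) ⇢? (q , true)  = Dec.map′ cross (λ { (cross q<p) → q<p }) (q ℕ.<? p)
(p , true)  ⇢? (q , false) = Dec.map′ cross (λ { (cross q<p) → q<p }) (q ℕ.<? p)

⇢⇒≢ : ∀ {p s q t} → (p , s) ⇢ (q , t) → p ≢ q
⇢⇒≢ (same p<q) = ℕ.<⇒≢ p<q
⇢⇒≢ (cross q<p) = ℕ.<⇒≢ q<p ∘ sym

⇢-total : ∀ {p q} s t → p ≢ q → (p , s) ⇢ (q , t) ⊎ (q , t) ⇢ (p , s)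
⇢-total {p} {q} s t p≢q with ℕ.<-cmp p q
... | tri≈ _ p≡q _ = ⊥-elim (p≢q p≡q)
⇢-total false false _ | tri< p<q _ _ = inj₁ (same p<q)
⇢-total true  true  _ | tri< p<q _ _ = inj₁ (same p<q)
⇢-total false true  _ | tri< p<q _ _ = inj₂ (cross p<q)
⇢-total true  false _ | tri< p<q _ _ = inj₂ (cross p<q)
⇢-total false false _ | tri> _ _ q<p = inj₂ (same q<p)
⇢-total true  true  _ | tri> _ _ q<p = inj₂ (same q<p)
⇢-total false true  _ | tri> _ _ q<p = inj₁ (cross q<p)
⇢-total true  false _ | tri> _ _ q<p = inj₁ (cross q<p)

⇢-asym : ∀ {a b} → a ⇢ b → ¬ b ⇢ a
⇢-asym {_ , false} {_ , false} (same p<q) (same q<p) = ℕ.<-asym p<q q<p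
⇢-asym {_ , true}  {_ , true}  (same p<q) (same q<p) = ℕ.<-asym p<q q<p
⇢-asym {_ , false} {_ , true}  (cross q<p) (cross p<q) = ℕ.<-asym p<q q<p
⇢-asym {_ , true}  {_ , false} (cross q<p) (cross p<q) = ℕ.<-asym p<q q<p

⇢-both-ends : ∀ {a q t t′} → a ⇢ (q , t) → a ⇢ (q , t′) → t ≢ t′ → ⊥
⇢-both-ends (same _) (same _) t≢t′ = t≢t′ refl
⇢-both-ends (same p<q) (cross q<p) _ = ℕ.<-asym p<q q<p
⇢-both-ends (cross q<p) (same p<q) _ = ℕ.<-asym p<q q<p
⇢-both-ends (cross _) (cross _) t≢t′ = t≢t′ refl

OnePerfectlyOrientable-co-mK₂ : ∀ m → OnePerfectlyOrientable (co-mK₂ m)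
OnePerfectlyOrientable-co-mK₂ m =
  o , OnePerfect-by {co-mK₂ m} {Points} labels⇢? ⇢⇒adj adj⇒⇢ (λ _ _ → ⇢-asym) perfect
  where
  label : Fin (n (co-mK₂ m)) → ℕ × Bool
  label x = pair m x , side m x
  Points : Fin (n (co-mK₂ m)) → Fin (n (co-mK₂ m)) → Set
  Points x y = label x ⇢ label y
  labels⇢? : ∀ x y → Dec (label x ⇢ label y)
  labels⇢? x y = label x ⇢? label y
  adjacent : ∀ x y → pair m x ≢ pair m y → adj (co-mK₂ m) x y ≡ true
  adjacent x y ≢pair = trans (co-mK₂-adj m x y) (cong not (dec-false (pair m x ℕ.≟ pair m y) ≢pair))
  ⇢⇒adj : ∀ x y → label x ⇢ label y → adj (co-mK₂ m) x y ≡ true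
  ⇢⇒adj x y = adjacent x y ∘ ⇢⇒≢
  adj⇒⇢ : ∀ x y → adj (co-mK₂ m) x y ≡ true → label x ⇢ label y ⊎ label y ⇢ label x
  adj⇒⇢ x y xy = ⇢-total (side m x) (side m y) ≢pair
    where
    ≢pair : pair m x ≢ pair m y
    ≢pair same-pair with trans (sym xy) (trans (co-mK₂-adj m x y) (cong not (dec-true (pair m x ℕ.≟ pair m y) same-pair)))
    ... | ()
  o : Orientation (co-mK₂ m)
  o = orientation-by {co-mK₂ m} {Points} labels⇢? ⇢⇒adj adj⇒⇢ (λ _ _ → ⇢-asym)
  perfect : ∀ v x y → label v ⇢ label x → label v ⇢ label y → x ≢ y → adj (co-mK₂ m) x y ≡ true
  perfect v x y vx vy x≢y with pair m x ℕ.≟ pair m y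
  ... | no ≢pair = adjacent x y ≢pair
  ... | yes same-pair = ⊥-elim (⇢-both-ends vx (subst (λ q → label v ⇢ (q , side m y)) (sym same-pair) vy)
                                              (x≢y ∘ pair-side-injective m x y same-pair))

-- Cographs without independent triples

data Reducible (C : Graph) : Set where
  single    : C ≅ K₁ → Reducible C
  universal : (H : Graph) → Cograph H → C ≅ addUniversal H → Reducible C
  twin      : (H : Graph) → Cograph H → (w : Fin (n H)) → C ≅ addTrueTwin H w → Reducible C

data Shape (C : Graph) : Set where
  reducible   : Reducible C → Shape C
  co-matching : (m : ℕ) → C ≅ co-mK₂ m → Shape C

Reducible-≅ : ∀ {G H} → G ≅ H → Reducible H → Reducible G
Reducible-≅ i (single j) = single (≅-trans i j)
Reducible-≅ i (universal H cH j) = universal H cH (≅-trans i j)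
Reducible-≅ i (twin H cH w j) = twin H cH w (≅-trans i j)

Shape-≅ : ∀ {G H} → G ≅ H → Shape H → Shape G
Shape-≅ i (reducible r) = reducible (Reducible-≅ i r)
Shape-≅ i (co-matching m j) = co-matching m (≅-trans i j)

Reducible-⊗ : ∀ {A B} → Cograph B → Reducible A → Reducible (A ⊗ B)
Reducible-⊗ {A} {B} cB (single i) = universal B cB (begin
  A ⊗ B   ≈⟨ combine-cong i ≅-refl ⟩
  K₁ ⊗ B  ≈⟨ combine-comm true K₁ B ⟩
  B ⊗ K₁  ∎)
  where open ≅-Reasoning
Reducible-⊗ {A} {B} cB (universal A′ cA′ i) = universal (A′ ⊗ B) (cg-join cA′ cB ≅-refl) (begin
  A ⊗ B            ≈⟨ combine-cong i ≅-refl ⟩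
  (A′ ⊗ K₁) ⊗ B    ≈⟨ combine-assoc true A′ K₁ B ⟩
  A′ ⊗ (K₁ ⊗ B)    ≈⟨ combine-cong (≅-refl {A′}) (combine-comm true K₁ B) ⟩
  A′ ⊗ (B ⊗ K₁)    ≈⟨ combine-assoc true A′ B K₁ ⟨
  (A′ ⊗ B) ⊗ K₁    ∎)
  where open ≅-Reasoning
Reducible-⊗ {A} {B} cB (twin A′ cA′ w i) = twin (A′ ⊗ B) (cg-join cA′ cB ≅-refl) (w ↑ˡ n B) (begin
  A ⊗ B                                 ≈⟨ combine-cong i ≅-refl ⟩
  addTrueTwin A′ w ⊗ B                  ≈⟨ combine-twin true A′ B w ⟩
  addTrueTwin (A′ ⊗ B) (w ↑ˡ n B)       ∎)
  where open ≅-Reasoning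

Shape-⊗ : ∀ {A B} → Cograph A → Cograph B → Shape A → Shape B → Shape (A ⊗ B)
Shape-⊗ cA cB (reducible r) _ = reducible (Reducible-⊗ cB r)
Shape-⊗ {A} {B} cA cB (co-matching a i) (reducible r) =
  reducible (Reducible-≅ (combine-comm true A B) (Reducible-⊗ cA r))
Shape-⊗ cA cB (co-matching a i) (co-matching b j) = co-matching (a + b) (≅-trans (combine-cong i j) (co-mK₂-+ a b))

Reducible-⊗-Clique : ∀ {A B} → Cograph A → Cograph B → Clique B → Reducible (A ⊗ B)
Reducible-⊗-Clique {A} {B} cA cB clique with Fin-subsingleton-or-≥2 (n B)
... | inj₁ all-equal = universal A cA (combine-cong ≅-refl (≅K₁ all-equal (Cograph-vertex cB)))
... | inj₂ (k , |B|≡2+k) = universal (A ⊗ complete (suc k)) (cg-join cA (Cograph-complete k) ≅-refl) (begin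
  A ⊗ B                             ≈⟨ combine-cong ≅-refl (Clique⇒≅complete clique) ⟩
  A ⊗ complete (n B)                ≈⟨ combine-cong ≅-refl (≡⇒≅ (cong complete |B|≡2+k)) ⟩
  A ⊗ complete (suc (suc k))        ≈⟨ combine-cong ≅-refl (complete-suc k) ⟩
  A ⊗ (K₁ ⊗ complete (suc k))       ≈⟨ combine-cong (≅-refl {A}) (combine-comm true K₁ (complete (suc k))) ⟩
  A ⊗ (complete (suc k) ⊗ K₁)       ≈⟨ combine-assoc true A (complete (suc k)) K₁ ⟨
  (A ⊗ complete (suc k)) ⊗ K₁       ∎)
  where open ≅-Reasoning

Reducible-⊕-Clique : ∀ {A B k} → Cograph B → Clique A → n A ≡ suc (suc k) → Reducible (A ⊕ B)
Reducible-⊕-Clique {A} {B} {k} cB clique |A|≡2+k =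
  twin (complete (suc k) ⊕ B) (cg-union (Cograph-complete k) cB ≅-refl) (zero ↑ˡ n B) (begin
    A ⊕ B                                              ≈⟨ combine-cong (Clique⇒≅complete clique) ≅-refl ⟩
    complete (n A) ⊕ B                                 ≈⟨ combine-cong (≡⇒≅ (cong complete |A|≡2+k)) ≅-refl ⟩
    complete (suc (suc k)) ⊕ B                         ≈⟨ combine-cong (complete-twin k) ≅-refl ⟩
    addTrueTwin (complete (suc k)) zero ⊕ B            ≈⟨ combine-twin false (complete (suc k)) B zero ⟩
    addTrueTwin (complete (suc k) ⊕ B) (zero ↑ˡ n B)   ∎)
  where open ≅-Reasoning

Shape-⊕-Clique : ∀ {A B} → Cograph A → Cograph B → Clique A → Clique B → Shape (A ⊕ B)
Shape-⊕-Clique {A} {B} cA cB cliqueA cliqueB with Fin-subsingleton-or-≥2 (n A) | Fin-subsingleton-or-≥2 (n B)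
... | inj₂ (_ , |A|≡2+k) | _ = reducible (Reducible-⊕-Clique cB cliqueA |A|≡2+k)
... | inj₁ _ | inj₂ (_ , |B|≡2+k) =
  reducible (Reducible-≅ (combine-comm false A B) (Reducible-⊕-Clique cA cliqueB |B|≡2+k))
... | inj₁ A-single | inj₁ B-single = co-matching 1 (begin
  A ⊕ B      ≈⟨ combine-cong (≅K₁ A-single (Cograph-vertex cA)) (≅K₁ B-single (Cograph-vertex cB)) ⟩
  K₁ ⊕ K₁    ≈⟨ co-mK₂-1 ⟨
  co-mK₂ 1   ∎)
  where open ≅-Reasoning

Shape-of-Cograph : ∀ {C} → Cograph C → ¬ IndependentTriple C → Shape C
Shape-of-Cograph (cg-K₁ i) _ = reducible (single i)
Shape-of-Cograph (cg-union {C} {A} {B} cA cB i) no-triple =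
  Shape-≅ i (Shape-⊕-Clique cA cB (Clique-⊕ˡ {A} {B} no-triple′ (Cograph-vertex cB))
                                  (Clique-⊕ˡ {B} {A} (no-triple′ ∘ IndependentTriple-↪ (≅⇒↪ (combine-comm false B A)))
                                                     (Cograph-vertex cA)))
  where
  no-triple′ : ¬ IndependentTriple (A ⊕ B)
  no-triple′ = no-triple ∘ IndependentTriple-↪ (≅⇒↪ (≅-sym i))
Shape-of-Cograph (cg-join {C} {A} {B} cA cB i) no-triple =
  Shape-≅ i (Shape-⊗ cA cB (Shape-of-Cograph cA (no-triple′ ∘ IndependentTriple-↪ (↑ˡ-↪ {true} {A} {B})))
                           (Shape-of-Cograph cB (no-triple′ ∘ IndependentTriple-↪ (↑ʳ-↪ {true} {A} {B}))))
  where
  no-triple′ : ¬ IndependentTriple (A ⊗ B)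
  no-triple′ = no-triple ∘ IndependentTriple-↪ (≅⇒↪ (≅-sym i))

Cond3⇒OnePerfectlyOrientable : ∀ G → Cond3 G → OnePerfectlyOrientable G
Cond3⇒OnePerfectlyOrientable G (inj₁ i) =
  OnePerfectlyOrientable-hereditary (≅⇒↪ i) OnePerfectlyOrientable-K₁
Cond3⇒OnePerfectlyOrientable G (inj₂ (inj₁ (m , _ , i))) =
  OnePerfectlyOrientable-hereditary (≅⇒↪ i) (OnePerfectlyOrientable-co-mK₂ m)
Cond3⇒OnePerfectlyOrientable G (inj₂ (inj₂ (inj₁ (A , B , _ , opoA , _ , opoB , i)))) =
  OnePerfectlyOrientable-hereditary (≅⇒↪ i) (OnePerfectlyOrientable-combine false A B opoA opoB λ ())
Cond3⇒OnePerfectlyOrientable G (inj₂ (inj₂ (inj₂ (inj₁ (H , _ , opoH , i))))) =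
  OnePerfectlyOrientable-hereditary (≅⇒↪ i)
    (OnePerfectlyOrientable-combine true H K₁ opoH OnePerfectlyOrientable-K₁ λ _ → Clique-K₁)
Cond3⇒OnePerfectlyOrientable G (inj₂ (inj₂ (inj₂ (inj₂ (H , _ , opoH , w , i))))) =
  OnePerfectlyOrientable-hereditary (≅⇒↪ i) (OnePerfectlyOrientable-twin H w opoH)

OnePerfectlyOrientable⇒Free : ∀ G → OnePerfectlyOrientable G → G Free K₂₃
OnePerfectlyOrientable⇒Free G opo K₂₃↪G =
  ¬OnePerfectlyOrientable-K₂₃ (OnePerfectlyOrientable-hereditary K₂₃↪G opo)

OrientableBelow : Graph → Set
OrientableBelow G = ∀ H → n H < n G → Cograph H → H Free K₂₃ → OnePerfectlyOrientable H

<-via-≅ : ∀ {G H m} → G ≅ H → m < n H → m < n G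
<-via-≅ i = subst (_ <_) (sym (≅⇒≡n i))

Reducible⇒Cond3 : ∀ {G} → OrientableBelow G → G Free K₂₃ → Reducible G → Cond3 G
Reducible⇒Cond3 _ _ (single i) = inj₁ i
Reducible⇒Cond3 smaller free (universal H cH i) = inj₂ (inj₂ (inj₂ (inj₁ (H , cH , opoH , i))))
  where
  opoH : OnePerfectlyOrientable H
  opoH = smaller H (<-via-≅ i (ℕ.m<m+n (n H) (s≤s z≤n))) cH
           (Free-hereditary (↪-trans ↑ˡ-↪ (≅⇒↪ (≅-sym i))) free)
Reducible⇒Cond3 smaller free (twin H cH w i) = inj₂ (inj₂ (inj₂ (inj₂ (H , cH , opoH , w , i))))
  where
  opoH : OnePerfectlyOrientable H
  opoH = smaller H (<-via-≅ i (ℕ.n<1+n (n H))) cH (Free-hereditary (↪-trans twin-↪ (≅⇒↪ (≅-sym i))) free)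

co-mK₂-⊗ : ∀ {A B m} → Fin (n A) → Fin (n B) → (A ⊗ B) ≅ co-mK₂ m → 2 ℕ.≤ m
co-mK₂-⊗ {A} {B} {zero} a b i with f i (a ↑ˡ n B)
... | ()
co-mK₂-⊗ {A} {B} {suc zero} a b i
  with trans (sym (adj-↑ˡ↑ʳ {true} {A} {B} a b))
             (trans (sym (pres i (a ↑ˡ n B) (n A ↑ʳ b))) (co-mK₂-1-edgeless (f i (a ↑ˡ n B)) (f i (n A ↑ʳ b))))
... | ()
co-mK₂-⊗ {m = suc (suc m)} _ _ _ = s≤s (s≤s z≤n)

Cond3-⊗ : ∀ {G A B} → OrientableBelow G → Cograph A → Cograph B → G ≅ (A ⊗ B) → G Free K₂₃ → Cond3 G
Cond3-⊗ {G} {A} {B} smaller cA cB i free with IndependentTriple? A | IndependentTriple? B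
... | yes tripleA | _ = Reducible⇒Cond3 smaller free (Reducible-≅ i
  (Reducible-⊗-Clique cA cB (¬NonEdge⇒Clique {B} λ non-edge →
    free (↪-trans (K₂₃-↪-⊗ non-edge tripleA) (≅⇒↪ (≅-trans (combine-comm true B A) (≅-sym i)))))))
... | no _ | yes tripleB = Reducible⇒Cond3 smaller free (Reducible-≅ (≅-trans i (combine-comm true A B))
  (Reducible-⊗-Clique cB cA (¬NonEdge⇒Clique {A} λ non-edge →
    free (↪-trans (K₂₃-↪-⊗ non-edge tripleB) (≅⇒↪ (≅-sym i))))))
... | no no-tripleA | no no-tripleB with Shape-of-Cograph (cg-join cA cB i) no-triple
  where
  no-triple : ¬ IndependentTriple G
  no-triple = Sum.[ no-tripleA , no-tripleB ] ∘ IndependentTriple-⊗ {A} {B} ∘ IndependentTriple-↪ (≅⇒↪ i)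
... | reducible r = Reducible⇒Cond3 smaller free r
... | co-matching m j =
  inj₂ (inj₁ (m , co-mK₂-⊗ (Cograph-vertex cA) (Cograph-vertex cB) (≅-trans (≅-sym i) j) , j))

Cond3-step : ∀ G → OrientableBelow G → Cograph G → G Free K₂₃ → Cond3 G
Cond3-step G _ (cg-K₁ i) _ = inj₁ i
Cond3-step G smaller (cg-union {A = A} {B} cA cB i) free =
  inj₂ (inj₂ (inj₁ (A , B , cA , opo cA ↑ˡ-↪ (ℕ.m<m+n (n A) (nonempty cB)) ,
                            cB , opo cB ↑ʳ-↪ (ℕ.m<n+m (n B) (nonempty cA)) , i)))
  where
  nonempty : ∀ {H} → Cograph H → 0 < n H
  nonempty {H} cH = ℕ.>-nonZero⁻¹ (n H) {{Fin.nonZeroIndex (Cograph-vertex cH)}}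
  opo : ∀ {H} → Cograph H → H ↪ (A ⊕ B) → n H < n A + n B → OnePerfectlyOrientable H
  opo cH e lt = smaller _ (<-via-≅ i lt) cH (Free-hereditary (↪-trans e (≅⇒↪ (≅-sym i))) free)
Cond3-step G smaller (cg-join cA cB i) free = Cond3-⊗ smaller cA cB i free

Free⇒Cond3 : ∀ G → Cograph G → G Free K₂₃ → Cond3 G
Free⇒Cond3 = All.wfRec (On.wellFounded n <-wellFounded) 0ℓ Claim step
  where
  open WF
  Claim : Graph → Set
  Claim G = Cograph G → G Free K₂₃ → Cond3 G
  step : ∀ G → WfRec (_<_ on n) Claim G → Claim G
  step G claim = Cond3-step G λ H lt cH free → Cond3⇒OnePerfectlyOrientable H (claim lt cH free)

theorem15 : (G : Graph) → Cograph G →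
    (OnePerfectlyOrientable G ⇔ (G Free K₂₃)) × ((G Free K₂₃) ⇔ Cond3 G)
theorem15 G cG =
  mk⇔ (OnePerfectlyOrientable⇒Free G) (Cond3⇒OnePerfectlyOrientable G ∘ Free⇒Cond3 G cG) ,
  mk⇔ (Free⇒Cond3 G cG) (OnePerfectlyOrientable⇒Free G ∘ Cond3⇒OnePerfectlyOrientable G)
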